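{- For any integers $q\ge p\ge 2$, $\bar{d}(K(2,p,q))=2$ if and only if $q\le \binom{p}{\lfloor p/2\rfloor}$.
   Context: $K(2,p,q)$ is the complete tripartite graph with partite sets of sizes $2$, $p$, $q$. For a connected bridgeless graph $G$, the orientation number $\bar d(G)$ is the minimum of the diameter $d(D)$ over all strong orientations $D$ of $G$ (orientations in which every two vertices are mutually reachable), where $d(D)$ is the maximum over ordered pairs of vertices of the length of a shortest directed path. -}

module Defs where

open import Data.Nat using (ℕ; zero; suc; _<_; _≤_)
open import Data.Fin using (Fin)
open import Data.Sum using (_⊎_; inj₁; inj₂)
open import Data.Product using (Σ; _×_; ∃; ∃-syntax; _,_)
open import Data.Empty using (⊥)
open import Data.Unit using (⊤)
open import Relation.Nullary using (¬_)
open import Relation.Binary.PropositionalEquality using (_≡_)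

record Graph (V : Set) : Set₁ where
  field
    Adj     : V → V → Set
    sym     : ∀ {u v} → Adj u v → Adj v u
    irrefl  : ∀ {u} → ¬ Adj u u
open Graph public

KVert : ℕ → ℕ → ℕ → Set
KVert a b c = Fin a ⊎ (Fin b ⊎ Fin c)

part : ∀ {a b c} → KVert a b c → Fin 3
part (inj₁ _)        = Fin.zero
part (inj₂ (inj₁ _)) = Fin.suc Fin.zero
part (inj₂ (inj₂ _)) = Fin.suc (Fin.suc Fin.zero)

KAdj : ∀ {a b c} → KVert a b c → KVert a b c → Set
KAdj u v = ¬ (part u ≡ part v)

K3 : (a b c : ℕ) → Graph (KVert a b c)
K3 a b c = record
  { Adj    = KAdj
  ; sym    = λ nuv e → nuv (Relation.Binary.PropositionalEquality.sym e)
  ; irrefl = λ n → n Relation.Binary.PropositionalEquality.refl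
  }

record Orientation {V : Set} (G : Graph V) : Set₁ where
  field
    Arc      : V → V → Set
    arc-adj  : ∀ {u v} → Arc u v → Adj G u v
    one-dir  : ∀ {u v} → Adj G u v → Arc u v ⊎ Arc v u
    antisym  : ∀ {u v} → Arc u v → ¬ Arc v u
open Orientation public

data Walk {V : Set} {G : Graph V} (D : Orientation G) : V → V → ℕ → Set where
  here : ∀ {u} → Walk D u u zero
  step : ∀ {u w v k} → Arc D u w → Walk D w v k → Walk D u v (suc k)

Dist : ∀ {V} {G : Graph V} → Orientation G → V → V → ℕ → Set
Dist D u v k = Walk D u v k × (∀ j → j < k → ¬ Walk D u v j)

Strong : ∀ {V} {G : Graph V} → Orientation G → Set
Strong D = ∀ u v → ∃[ k ] Walk D u v k

Diameter : ∀ {V} {G : Graph V} → Orientation G → ℕ → Set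
Diameter D d = (∀ u v → ∃[ k ] (Dist D u v k × k ≤ d)) × (∃[ u ] ∃[ v ] Dist D u v d)

OrientationNumber : ∀ {V} → Graph V → ℕ → Set₁
OrientationNumber G d =
  (Σ (Orientation G) λ D → Strong D × Diameter D d)
  × (∀ (D : Orientation G) → Strong D → ∀ e → Diameter D e → d ≤ e)

-- Sperner: an antichain of subsets of a p-set has at most C(p, ⌊p/2⌋) members. We prove the LYM
-- inequality ∑_{A ∈ F} |A|! (p − |A|)! ≤ p! by deleting one point at a time, and compare each term
-- with ⌊p/2⌋! ⌈p/2⌉!.
--
-- Necessity. The two vertices x₁, x₂ of the 2-part are non-adjacent, so every orientation has diameter
-- at least 2. If some orientation has diameter 2, every vertex of the q-part is assigned a subset of
-- the p-part — its out- or in-neighbourhood, or that of x₁ or x₂, according to how it is joined to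
-- x₁ and x₂ — and the two-step paths between the q vertices force these q subsets to be incomparable.
--
-- Sufficiency. Take q pairwise incomparable ⌊p/2⌋-subsets F w of the p-part, among them the p cyclic
-- intervals, which separate points. Orient x₁ → P → x₂ → Q → x₁, and u → w when u ∈ F w, w → u
-- otherwise; every ordered pair is then joined by a directed path of length at most 2.

module Submission where

open import Defs hiding (sym)
open import Data.Nat using (ℕ; zero; suc; pred; _+_; _*_; _∸_; _≤_; _<_; _≤?_; _<?_; z≤n; s≤s; s≤s⁻¹; _!; _/_; _%_)
open import Data.Nat.Properties hiding (_≟_)
open import Data.Nat.DivMod using (m≡m%n+[m/n]*n; m%n<n; m/n*n≤m; m/n*n≡m; m/n≤m; m≥n⇒m/n>0)
open import Data.Nat.ListAction using (sum)
open import Data.Nat.Combinatorics using (_C_; nCk≡n!/k![n-k]!; k![n∸k]!∣n!; nCk+nC[k+1]≡[n+1]C[k+1])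
open import Data.Bool using (Bool; true; false; if_then_else_)
open import Data.Bool.Properties using (¬-not) renaming (_≟_ to _≟ᵇ_)
open import Data.Fin using (Fin; toℕ; fromℕ<; inject≤; punchIn; punchOut; _≟_) renaming (zero to fz; suc to fs)
open import Data.Fin.Properties
  using (punchIn-punchOut; punchOut-injective; toℕ-injective; toℕ<n; toℕ-fromℕ<; toℕ-inject≤; inject≤-injective;
         any?; all?; ¬∀⟶∃¬; injective⇒≤)
  renaming (suc-injective to fs-injective)
open import Data.Vec.Functional as Vector using ()
open import Data.List as List using (List; []; _∷_; length; _++_; filter; lookup; tabulate)
open import Data.List.Properties using (length-tabulate; map-cong-local; length-map; length-++; partition-defn)
open import Data.List.Membership.Propositional.Properties using (∈-lookup)
open import Data.List.Relation.Unary.All as All using (All; []; _∷_)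
import Data.List.Relation.Unary.All.Properties as All
open import Data.List.Relation.Unary.Any as Any using (Any; here; there)
import Data.List.Relation.Unary.Any.Properties as Any
open import Data.List.Relation.Unary.AllPairs as AllPairs using (AllPairs; []; _∷_)
import Data.List.Relation.Unary.AllPairs.Properties as AllPairs
import Data.List.Relation.Binary.Permutation.Setoid as Permutation using (_↭_)
import Data.List.Relation.Binary.Permutation.Setoid.Properties as Permutationₚ
open import Data.Product using (∃-syntax; _×_; _,_; proj₁; proj₂; uncurry)
open import Data.Sum using (_⊎_; inj₁; inj₂; swap)
open import Data.Sum.Properties using (≡-dec)
open import Data.Empty using (⊥; ⊥-elim)
open import Function using (_∘_; _⇔_; mk⇔)
open import Function.Definitions using (Injective)
open import Function.Construct.Composition using (_⇔-∘_)
open import Relation.Nullary using (¬_; Dec; yes; no; does; ¬?)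
open import Relation.Nullary.Decidable using (dec-true; dec-false; _×-dec_)
open import Relation.Unary.Properties using (∁?)
open import Relation.Binary using (Decidable; DecidableEquality; Symmetric)
open import Relation.Binary.PropositionalEquality
open import Algebra.Properties.CommutativeMonoid.Sum +-0-commutativeMonoid
  using (sum-syntax; sum-remove; sum-cong-≗; ∑-distrib-+; sum-replicate-zero)
open import Algebra.Properties.CommutativeSemigroup +-commutativeSemigroup using (xy∙z≈xz∙y)

Subset : ℕ → Set
Subset n = Fin n → Bool

χ : Bool → ℕ
χ b = if b then 1 else 0

∣_∣ : ∀ {n} → Subset n → ℕ
∣_∣ {n} A = ∑[ i < n ] χ (A i)

infix 4 _⊈_

_⊈_ : ∀ {n} → Subset n → Subset n → Set
A ⊈ B = ∃[ i ] A i ≡ true × B i ≡ false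

Incomparable : ∀ {n} → Subset n → Subset n → Set
Incomparable A B = A ⊈ B × B ⊈ A

Antichain : ∀ {m n} → (Fin m → Subset n) → Set
Antichain F = ∀ {i j} → i ≢ j → Incomparable (F i) (F j)

Full : ∀ {n} → Subset n → Set
Full A = ∀ i → A i ≡ true

incomparable-sym : ∀ {n} → Symmetric (Incomparable {n})
incomparable-sym (A⊈B , B⊈A) = B⊈A , A⊈B

≗-¬incomparable : ∀ {n} {A B C : Subset n} → A ≗ C → B ≗ C → ¬ Incomparable A B
≗-¬incomparable A≗C B≗C ((i , Ai , Bi) , _) with () ← trans (sym Ai) (trans (A≗C i) (trans (sym (B≗C i)) Bi))

⊈-full : ∀ {n} {A B : Subset n} → Full B → ¬ A ⊈ B
⊈-full B-full (i , _ , Bi) with () ← trans (sym (B-full i)) Bi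

∣∣-punchIn : ∀ {n} (A : Subset (suc n)) i → ∣ A ∣ ≡ χ (A i) + ∣ A ∘ punchIn i ∣
∣∣-punchIn A i = sum-remove {i = i} (χ ∘ A)

∣∣-punchIn-false : ∀ {n} (A : Subset (suc n)) {i} → A i ≡ false → ∣ A ∣ ≡ ∣ A ∘ punchIn i ∣
∣∣-punchIn-false A {i} Ai≡false = trans (∣∣-punchIn A i) (cong (λ b → χ b + ∣ A ∘ punchIn i ∣) Ai≡false)

∣∣≤n : ∀ {n} (A : Subset n) → ∣ A ∣ ≤ n
∣∣≤n {zero} A = z≤n
∣∣≤n {suc n} A with A fz
... | true = s≤s (∣∣≤n (A ∘ fs))
... | false = m≤n⇒m≤1+n (∣∣≤n (A ∘ fs))

∣∣-full : ∀ {n} {A : Subset n} → Full A → ∣ A ∣ ≡ n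
∣∣-full {zero} A-full = refl
∣∣-full {suc n} {A} A-full rewrite A-full fz = cong suc (∣∣-full (A-full ∘ fs))

∣∅∣ : ∀ n → ∣ (λ (_ : Fin n) → false) ∣ ≡ 0
∣∅∣ zero = refl
∣∅∣ (suc n) = ∣∅∣ n

∣∣-reindex : ∀ {n} (A : Subset n) {σ : Fin n → Fin n} → Injective _≡_ _≡_ σ → ∣ A ∘ σ ∣ ≡ ∣ A ∣
∣∣-reindex {zero} A σ-inj = refl
∣∣-reindex {suc n} A {σ} σ-inj = begin
    χ (A i) + ∣ A ∘ σ ∘ fs ∣
  ≡⟨ cong (χ (A i) +_) (sum-cong-≗ (cong (χ ∘ A) ∘ sym ∘ punchIn-punchOut ∘ i≢σ)) ⟩
    χ (A i) + ∣ A ∘ punchIn i ∘ τ ∣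
  ≡⟨ cong (χ (A i) +_) (∣∣-reindex (A ∘ punchIn i) τ-inj) ⟩
    χ (A i) + ∣ A ∘ punchIn i ∣
  ≡⟨ ∣∣-punchIn A i ⟨
    ∣ A ∣
  ∎
  where
  open ≡-Reasoning
  i = σ fz
  i≢σ : ∀ j → i ≢ σ (fs j)
  i≢σ j e with () ← σ-inj e
  τ : Fin n → Fin n
  τ j = punchOut (i≢σ j)
  τ-inj : Injective _≡_ _≡_ τ
  τ-inj {x} {y} e = fs-injective (σ-inj (punchOut-injective (i≢σ x) (i≢σ y) e))

⊈-or-∣∣≤ : ∀ {n} (A B : Subset n) → A ⊈ B ⊎ ∣ A ∣ ≤ ∣ B ∣
⊈-or-∣∣≤ {zero} A B = inj₂ z≤n
⊈-or-∣∣≤ {suc n} A B with A fz in A₀ | B fz in B₀ | ⊈-or-∣∣≤ (A ∘ fs) (B ∘ fs)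
... | true  | false | _ = inj₁ (fz , A₀ , B₀)
... | _     | _     | inj₁ (i , Ai , Bi) = inj₁ (fs i , Ai , Bi)
... | true  | true  | inj₂ ≤ = inj₂ (s≤s ≤)
... | false | true  | inj₂ ≤ = inj₂ (m≤n⇒m≤1+n ≤)
... | false | false | inj₂ ≤ = inj₂ ≤

∣∣<⇒⊈ : ∀ {n} {A B : Subset n} → ∣ B ∣ < ∣ A ∣ → A ⊈ B
∣∣<⇒⊈ {A = A} {B} ∣B∣<∣A∣ with ⊈-or-∣∣≤ A B
... | inj₁ A⊈B = A⊈B
... | inj₂ ∣A∣≤∣B∣ = ⊥-elim (<⇒≱ ∣B∣<∣A∣ ∣A∣≤∣B∣)

∑-mono-≤ : ∀ {n} {f g : Fin n → ℕ} → (∀ i → f i ≤ g i) → ∑[ i < n ] f i ≤ ∑[ i < n ] g i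
∑-mono-≤ {zero} f≤g = z≤n
∑-mono-≤ {suc n} f≤g = +-mono-≤ (f≤g fz) (∑-mono-≤ (f≤g ∘ fs))

∑-const : ∀ n c → ∑[ i < n ] c ≡ n * c
∑-const zero c = refl
∑-const (suc n) c = cong (c +_) (∑-const n c)

sum-∑-comm : ∀ {n} {T : Set} (t : Fin n → T → ℕ) (F : List T) →
  sum (List.map (λ A → ∑[ i < n ] t i A) F) ≡ ∑[ i < n ] sum (List.map (t i) F)
sum-∑-comm {n} t [] = sym (sum-replicate-zero n)
sum-∑-comm t (A ∷ F) = trans (cong (_ +_) (sum-∑-comm t F)) (sym (∑-distrib-+ (λ i → t i A) _))

∑-nonmembers : ∀ {n} (A : Subset n) c → ∑[ i < n ] (if A i then 0 else c) ≡ (n ∸ ∣ A ∣) * c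
∑-nonmembers {zero} A c = refl
∑-nonmembers {suc n} A c with A fz
... | true = ∑-nonmembers (A ∘ fs) c
... | false = begin
    c + ∑[ i < n ] (if A (fs i) then 0 else c)   ≡⟨ cong (c +_) (∑-nonmembers (A ∘ fs) c) ⟩
    c + (n ∸ ∣ A ∘ fs ∣) * c                     ≡⟨ cong (_* c) (+-∸-assoc 1 (∣∣≤n (A ∘ fs))) ⟨
    (suc n ∸ ∣ A ∘ fs ∣) * c                     ∎
  where open ≡-Reasoning

-- The LYM inequality and Sperner's theorem

-- c ! * (n ∸ c) ! is the number of maximal chains of subsets of Fin n through a fixed c-set.
chainsThrough : ℕ → ℕ → ℕ
chainsThrough n c = c ! * (n ∸ c) !

chainsThrough-suc : ∀ {n c} → c ≤ n → (suc n ∸ c) * chainsThrough n c ≡ chainsThrough (suc n) c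
chainsThrough-suc {n} {c} c≤n rewrite +-∸-assoc 1 c≤n = begin
    suc m * (c ! * m !)   ≡⟨ *-assoc (suc m) (c !) (m !) ⟨
    suc m * c ! * m !     ≡⟨ cong (_* m !) (*-comm (suc m) (c !)) ⟩
    c ! * suc m * m !     ≡⟨ *-assoc (c !) (suc m) (m !) ⟩
    c ! * (suc m * m !)   ∎
  where
  open ≡-Reasoning
  m = n ∸ c

-- A maximal chain through A ends by adding some j ∉ A; below that step it is a maximal chain of
-- subsets of Fin (suc n) ∖ {j} through A.
chainsThrough-removals : ∀ {n} (A : Subset (suc n)) (i : Fin (suc n)) → A i ≡ false →
  ∑[ j < suc n ] (if A j then 0 else chainsThrough n ∣ A ∘ punchIn j ∣) ≡ chainsThrough (suc n) ∣ A ∣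
chainsThrough-removals {n} A i Ai≡false = begin
    ∑[ j < suc n ] (if A j then 0 else chainsThrough n ∣ A ∘ punchIn j ∣)
  ≡⟨ sum-cong-≗ removal-card ⟩
    ∑[ j < suc n ] (if A j then 0 else chainsThrough n ∣ A ∣)
  ≡⟨ ∑-nonmembers A (chainsThrough n ∣ A ∣) ⟩
    (suc n ∸ ∣ A ∣) * chainsThrough n ∣ A ∣
  ≡⟨ chainsThrough-suc ∣A∣≤n ⟩
    chainsThrough (suc n) ∣ A ∣
  ∎
  where
  open ≡-Reasoning
  removal-card : ∀ j → (if A j then 0 else chainsThrough n ∣ A ∘ punchIn j ∣)
                     ≡ (if A j then 0 else chainsThrough n ∣ A ∣)
  removal-card j with A j in Aj
  ... | true = refl
  ... | false = cong (chainsThrough n) (sym (∣∣-punchIn-false A Aj))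
  ∣A∣≤n : ∣ A ∣ ≤ n
  ∣A∣≤n = subst (_≤ n) (sym (∣∣-punchIn-false A Ai≡false)) (∣∣≤n (A ∘ punchIn i))

restrict : ∀ {n} → Fin (suc n) → List (Subset (suc n)) → List (Subset n)
restrict i [] = []
restrict i (A ∷ F) = if A i then restrict i F else (A ∘ punchIn i) ∷ restrict i F

sum-restrict : ∀ {n} (f : Subset n → ℕ) i (F : List (Subset (suc n))) →
  sum (List.map f (restrict i F)) ≡ sum (List.map (λ A → if A i then 0 else f (A ∘ punchIn i)) F)
sum-restrict f i [] = refl
sum-restrict f i (A ∷ F) with A i
... | true = sum-restrict f i F
... | false = cong (f (A ∘ punchIn i) +_) (sum-restrict f i F)

⊈-restrict : ∀ {n} {A B : Subset (suc n)} {i} → A i ≡ false → A ⊈ B → A ∘ punchIn i ⊈ B ∘ punchIn i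
⊈-restrict {A = A} {B} {i} Ai≡false (j , Aj , Bj) with i ≟ j
... | yes refl with () ← trans (sym Ai≡false) Aj
... | no i≢j = punchOut i≢j , subst (λ k → A k ≡ true) (sym (punchIn-punchOut i≢j)) Aj
                            , subst (λ k → B k ≡ false) (sym (punchIn-punchOut i≢j)) Bj

restrict-antichain : ∀ {n} i {F : List (Subset (suc n))} →
  AllPairs Incomparable F → AllPairs Incomparable (restrict i F)
restrict-antichain i {[]} [] = []
restrict-antichain i {A ∷ F} (A∼F ∷ F-ac) with A i in Ai
... | true = restrict-antichain i F-ac
... | false = restrict-incomparable F A∼F ∷ restrict-antichain i F-ac
  where
  restrict-incomparable : ∀ G → All (Incomparable A) G → All (Incomparable (A ∘ punchIn i)) (restrict i G)
  restrict-incomparable [] [] = []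
  restrict-incomparable (B ∷ G) ((A⊈B , B⊈A) ∷ A∼G) with B i in Bi
  ... | true = restrict-incomparable G A∼G
  ... | false = (⊈-restrict Ai A⊈B , ⊈-restrict Bi B⊈A) ∷ restrict-incomparable G A∼G

antichain-with-full : ∀ {n} {F : List (Subset n)} → AllPairs Incomparable F → Any Full F → ∃[ A ] Full A × F ≡ A ∷ []
antichain-with-full {F = A ∷ []} _ (here A-full) = A , A-full , refl
antichain-with-full {F = A ∷ B ∷ _} (((_ , B⊈A) ∷ _) ∷ _) (here A-full) = ⊥-elim (⊈-full A-full B⊈A)
antichain-with-full (A∼F ∷ _) (there B-full) with (A⊈B , _) , B-full ← All.lookupAny A∼F B-full
  = ⊥-elim (⊈-full B-full A⊈B)

lym : ∀ n (F : List (Subset n)) → AllPairs Incomparable F → sum (List.map (chainsThrough n ∘ ∣_∣) F) ≤ n !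
lym n F F-ac with Any.any? (λ A → all? (λ i → A i ≟ᵇ true)) F
... | yes full∈F with A , A-full , refl ← antichain-with-full F-ac full∈F
  rewrite ∣∣-full A-full | n∸n≡0 n = ≤-reflexive (trans (+-identityʳ _) (*-identityʳ _))
lym zero [] _ | no _ = z≤n
lym zero (A ∷ F) F-ac | no no-full = ⊥-elim (no-full (here (λ ())))
lym (suc n) F F-ac | no no-full = begin
    sum (List.map (chainsThrough (suc n) ∘ ∣_∣) F)
  ≡⟨ cong sum (map-cong-local (All.map removals (All.¬Any⇒All¬ F no-full))) ⟨
    sum (List.map (λ A → ∑[ i < suc n ] t i A) F)
  ≡⟨ sum-∑-comm t F ⟩
    ∑[ i < suc n ] sum (List.map (t i) F)
  ≡⟨ sum-cong-≗ (λ i → sum-restrict (chainsThrough n ∘ ∣_∣) i F) ⟨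
    ∑[ i < suc n ] sum (List.map (chainsThrough n ∘ ∣_∣) (restrict i F))
  ≤⟨ ∑-mono-≤ (λ i → lym n (restrict i F) (restrict-antichain i F-ac)) ⟩
    ∑[ i < suc n ] (n !)
  ≡⟨ ∑-const (suc n) (n !) ⟩
    suc n !
  ∎
  where
  open ≤-Reasoning
  t : Fin (suc n) → Subset (suc n) → ℕ
  t i A = if A i then 0 else chainsThrough n ∣ A ∘ punchIn i ∣
  removals : ∀ {A} → ¬ Full A → ∑[ i < suc n ] t i A ≡ chainsThrough (suc n) ∣ A ∣
  removals {A} ¬full with i , ¬Ai ← ¬∀⟶∃¬ (suc n) _ (λ i → A i ≟ᵇ true) ¬full
    = chainsThrough-removals A i (¬-not ¬Ai)

chainsThrough-step : ∀ {n c} → suc c ≤ n ∸ c → chainsThrough n (suc c) ≤ chainsThrough n c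
chainsThrough-step {n} {c} c<n∸c with n ∸ c in n∸c≡
... | suc r rewrite trans (sym (pred[m∸n]≡m∸[1+n] n c)) (cong pred n∸c≡) = begin
    suc c * c ! * r !     ≡⟨ cong (_* r !) (*-comm (suc c) (c !)) ⟩
    c ! * suc c * r !     ≡⟨ *-assoc (c !) (suc c) (r !) ⟩
    c ! * (suc c * r !)   ≤⟨ *-monoʳ-≤ (c !) (*-monoˡ-≤ (r !) c<n∸c) ⟩
    c ! * (suc r * r !)   ∎
  where open ≤-Reasoning

chainsThrough-antitone : ∀ {n c d} → c ≤ d → d + d ≤ n → chainsThrough n d ≤ chainsThrough n c
chainsThrough-antitone {d = zero} z≤n _ = ≤-refl
chainsThrough-antitone {n} {c} {suc d} c≤1+d 2d≤n with m≤n⇒m<n∨m≡n c≤1+d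
... | inj₂ refl = ≤-refl
... | inj₁ (s≤s c≤d) = ≤-trans (chainsThrough-step 1+d≤n∸d) (chainsThrough-antitone c≤d d+d≤n)
  where
  d+d≤n : d + d ≤ n
  d+d≤n = ≤-trans (+-mono-≤ (n≤1+n d) (n≤1+n d)) 2d≤n
  1+d≤n∸d : suc d ≤ n ∸ d
  1+d≤n∸d = m+n≤o⇒m≤o∸n (suc d) (≤-trans (+-monoʳ-≤ (suc d) (n≤1+n d)) 2d≤n)

chainsThrough-complement : ∀ {n c} → c ≤ n → chainsThrough n c ≡ chainsThrough n (n ∸ c)
chainsThrough-complement {n} {c} c≤n rewrite m∸[m∸n]≡n c≤n = *-comm (c !) ((n ∸ c) !)

half+half≤n : ∀ n → n / 2 + n / 2 ≤ n
half+half≤n n = begin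
  n / 2 + n / 2       ≡⟨ cong (n / 2 +_) (+-identityʳ (n / 2)) ⟨
  2 * (n / 2)         ≡⟨ *-comm 2 (n / 2) ⟩
  n / 2 * 2           ≤⟨ m/n*n≤m n 2 ⟩
  n                   ∎
  where open ≤-Reasoning

n≤1+half+half : ∀ n → n ≤ suc (n / 2 + n / 2)
n≤1+half+half n = begin
  n                       ≡⟨ m≡m%n+[m/n]*n n 2 ⟩
  n % 2 + n / 2 * 2       ≤⟨ +-monoˡ-≤ (n / 2 * 2) (s≤s⁻¹ (m%n<n n 2)) ⟩
  suc (n / 2 * 2)         ≡⟨ cong suc (*-comm (n / 2) 2) ⟩
  suc (2 * (n / 2))       ≡⟨ cong (λ m → suc (n / 2 + m)) (+-identityʳ (n / 2)) ⟩
  suc (n / 2 + n / 2)     ∎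
  where open ≤-Reasoning

chainsThrough-min : ∀ {n c} → c ≤ n → chainsThrough n (n / 2) ≤ chainsThrough n c
chainsThrough-min {n} {c} c≤n with c ≤? n / 2
... | yes c≤half = chainsThrough-antitone c≤half (half+half≤n n)
... | no c≰half = subst (chainsThrough n (n / 2) ≤_) (sym (chainsThrough-complement c≤n))
                    (chainsThrough-antitone n∸c≤half (half+half≤n n))
  where
  n∸c≤half : n ∸ c ≤ n / 2
  n∸c≤half = m≤n+o⇒m∸n≤o n c (≤-trans (n≤1+half+half n) (+-monoˡ-≤ (n / 2) (≰⇒> c≰half)))

binomial*chainsThrough : ∀ n {k} → k ≤ n → (n C k) * chainsThrough n k ≡ n !
binomial*chainsThrough n {k} k≤n =
  trans (cong (_* chainsThrough n k) (nCk≡n!/k![n-k]! k≤n)) (m/n*n≡m (k![n∸k]!∣n! k≤n))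
  where instance _ = k !* (n ∸ k) !≢0

sperner : ∀ n (F : List (Subset n)) → AllPairs Incomparable F → length F ≤ n C (n / 2)
sperner n F F-ac = *-cancelʳ-≤ (length F) (n C (n / 2)) (chainsThrough n (n / 2)) (begin
    length F * chainsThrough n (n / 2)         ≤⟨ lower-bound F ⟩
    sum (List.map (chainsThrough n ∘ ∣_∣) F)   ≤⟨ lym n F F-ac ⟩
    n !                                        ≡⟨ binomial*chainsThrough n (m/n≤m n 2) ⟨
    (n C (n / 2)) * chainsThrough n (n / 2)    ∎)
  where
  open ≤-Reasoning
  instance _ = (n / 2) !* (n ∸ n / 2) !≢0
  lower-bound : ∀ G → length G * chainsThrough n (n / 2) ≤ sum (List.map (chainsThrough n ∘ ∣_∣) G)
  lower-bound [] = z≤n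
  lower-bound (A ∷ G) = +-mono-≤ (chainsThrough-min (∣∣≤n A)) (lower-bound G)

sperner-family : ∀ {m n} (F : Fin m → Subset n) → Antichain F → m ≤ n C (n / 2)
sperner-family {m} {n} F F-ac =
  subst (_≤ n C (n / 2)) (length-tabulate F) (sperner n (tabulate F) (AllPairs.tabulate⁺ F-ac))

-- Antichains of k-subsets that separate points

kSubsets : ∀ n → ℕ → List (Subset n)
kSubsets n zero = (λ _ → false) ∷ []
kSubsets zero (suc k) = []
kSubsets (suc n) (suc k) = List.map (true Vector.∷_) (kSubsets n k) ++ List.map (false Vector.∷_) (kSubsets n (suc k))

length-kSubsets : ∀ n k → length (kSubsets n k) ≡ n C k
length-kSubsets n zero = refl
length-kSubsets zero (suc k) = refl
length-kSubsets (suc n) (suc k) = begin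
    length (List.map (true Vector.∷_) (kSubsets n k) ++ List.map (false Vector.∷_) (kSubsets n (suc k)))
  ≡⟨ length-++ (List.map (true Vector.∷_) (kSubsets n k)) ⟩
    length (List.map (true Vector.∷_) (kSubsets n k)) + length (List.map (false Vector.∷_) (kSubsets n (suc k)))
  ≡⟨ cong₂ _+_ (trans (length-map _ (kSubsets n k)) (length-kSubsets n k))
               (trans (length-map _ (kSubsets n (suc k))) (length-kSubsets n (suc k))) ⟩
    n C k + n C suc k
  ≡⟨ nCk+nC[k+1]≡[n+1]C[k+1] n k ⟩
    suc n C suc k
  ∎
  where open ≡-Reasoning

kSubsets-card : ∀ n k → All (λ A → ∣ A ∣ ≡ k) (kSubsets n k)
kSubsets-card n zero = ∣∅∣ n ∷ []
kSubsets-card zero (suc k) = []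
kSubsets-card (suc n) (suc k) = All.++⁺ (All.map⁺ (All.map (cong suc) (kSubsets-card n k)))
                                        (All.map⁺ (kSubsets-card n (suc k)))

incomparable-cons : ∀ {n} b {A B : Subset n} → Incomparable A B → Incomparable (b Vector.∷ A) (b Vector.∷ B)
incomparable-cons b ((i , Ai , Bi) , (j , Bj , Aj)) = (fs i , Ai , Bi) , (fs j , Bj , Aj)

kSubsets-antichain : ∀ n k → AllPairs Incomparable (kSubsets n k)
kSubsets-antichain n zero = [] ∷ []
kSubsets-antichain zero (suc k) = []
kSubsets-antichain (suc n) (suc k) = AllPairs.++⁺
  (AllPairs.map⁺ (AllPairs.map (incomparable-cons true) (kSubsets-antichain n k)))
  (AllPairs.map⁺ (AllPairs.map (incomparable-cons false) (kSubsets-antichain n (suc k))))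
  (All.map⁺ (All.map (λ ∣A∣≡k → All.map⁺ (All.map (true∷-false∷-incomparable ∣A∣≡k) (kSubsets-card n (suc k))))
                     (kSubsets-card n k)))
  where
  true∷-false∷-incomparable : ∀ {A B : Subset n} → ∣ A ∣ ≡ k → ∣ B ∣ ≡ suc k →
    Incomparable (true Vector.∷ A) (false Vector.∷ B)
  true∷-false∷-incomparable {A} {B} ∣A∣≡k ∣B∣≡1+k
    with i , Bi , Ai ← ∣∣<⇒⊈ {A = B} {B = A} (subst₂ _<_ (sym ∣A∣≡k) (sym ∣B∣≡1+k) ≤-refl)
    = (fz , refl , refl) , (fs i , Bi , Ai)

∅-unique : ∀ {n} (A : Subset n) → ∣ A ∣ ≡ 0 → (λ _ → false) ≗ A
∅-unique {suc n} A ∣A∣≡0 with A fz in A₀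
... | false = λ { fz → sym A₀ ; (fs i) → ∅-unique (A ∘ fs) ∣A∣≡0 i }

cons-≗ : ∀ {n b} {A : Subset (suc n)} {B} → A fz ≡ b → B ≗ A ∘ fs → (b Vector.∷ B) ≗ A
cons-≗ A₀ B≗A fz = sym A₀
cons-≗ A₀ B≗A (fs i) = B≗A i

kSubsets-complete : ∀ n k (A : Subset n) → ∣ A ∣ ≡ k → Any (_≗ A) (kSubsets n k)
kSubsets-complete n zero A ∣A∣≡0 = here (∅-unique A ∣A∣≡0)
kSubsets-complete (suc n) (suc k) A ∣A∣≡1+k with A fz in A₀
... | true = Any.++⁺ˡ (Any.map⁺ (Any.map (cons-≗ A₀) (kSubsets-complete n k (A ∘ fs) (suc-injective ∣A∣≡1+k))))
... | false = Any.++⁺ʳ _ (Any.map⁺ (Any.map (cons-≗ A₀) (kSubsets-complete n (suc k) (A ∘ fs) ∣A∣≡1+k)))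

-- For a, b < p this says a + t ≡ b modulo p.
data AddMod (p a t b : ℕ) : Set where
  exact : a + t ≡ b → AddMod p a t b
  wrap  : a + t ≡ b + p → AddMod p a t b

+-reassoc : ∀ a t {s x y} → a + t ≡ x → x + s ≡ y → a + (t + s) ≡ y
+-reassoc a t {s} e e' = trans (sym (+-assoc a t s)) (trans (cong (_+ s) e) e')

module _ {p : ℕ} where

  addMod-exists : ∀ {a b} → a < p → b < p → ∃[ t ] t < p × AddMod p a t b
  addMod-exists {a} {b} a<p b<p with a ≤? b
  ... | yes a≤b = b ∸ a , ≤-<-trans (m∸n≤m b a) b<p , exact (m+[n∸m]≡n a≤b)
  ... | no a≰b = b + p ∸ a , t<p , wrap a+t≡b+p
    where
    a+t≡b+p : a + (b + p ∸ a) ≡ b + p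
    a+t≡b+p = m+[n∸m]≡n (≤-trans (<⇒≤ a<p) (m≤n+m p b))
    t<p : b + p ∸ a < p
    t<p = +-cancelˡ-< a _ _ (subst (_< a + p) (sym a+t≡b+p) (+-monoˡ-< p (≰⇒> a≰b)))

  addMod-comm : ∀ {a t b} → AddMod p a t b → AddMod p t a b
  addMod-comm {a} {t} (exact e) = exact (trans (+-comm t a) e)
  addMod-comm {a} {t} (wrap e) = wrap (trans (+-comm t a) e)

  addMod-functional : ∀ {a t t' b} → t < p → t' < p → AddMod p a t b → AddMod p a t' b → t ≡ t'
  addMod-functional _ _ (exact e) (exact e') = +-cancelˡ-≡ _ _ _ (trans e (sym e'))
  addMod-functional _ _ (wrap e) (wrap e') = +-cancelˡ-≡ _ _ _ (trans e (sym e'))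
  addMod-functional _ t'<p (exact e) (wrap e') = ⊥-elim (wraps-once t'<p e e')
    where
    wraps-once : ∀ {a t t' b} → t' < p → a + t ≡ b → a + t' ≡ b + p → ⊥
    wraps-once {a} {t} {t'} t'<p e e' = <⇒≱ t'<p (begin
      p       ≤⟨ m≤n+m p t ⟩
      t + p   ≡⟨ +-cancelˡ-≡ a _ _ (trans (sym (+-assoc a t p)) (trans (cong (_+ p) e) (sym e'))) ⟩
      t'      ∎)
      where open ≤-Reasoning
  addMod-functional t<p t'<p (wrap e) (exact e') = sym (addMod-functional t'<p t<p (exact e') (wrap e))

  addMod-injective : ∀ {a t b b'} → b < p → b' < p → AddMod p a t b → AddMod p a t b' → b ≡ b'
  addMod-injective _ _ (exact e) (exact e') = trans (sym e) e'
  addMod-injective _ _ (wrap e) (wrap e') = +-cancelʳ-≡ _ _ _ (trans (sym e) e')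
  addMod-injective {b' = b'} b<p _ (exact e) (wrap e') =
    ⊥-elim (<⇒≱ b<p (subst (p ≤_) (trans (sym e') e) (m≤n+m p b')))
  addMod-injective {a} {t} b<p b'<p (wrap e) (exact e') = sym (addMod-injective {a} {t} b'<p b<p (exact e') (wrap e))

  addMod-trans : ∀ {a t s b c} → a < p → t + s < p → AddMod p a t b → AddMod p b s c → AddMod p a (t + s) c
  addMod-trans {a} {t} {s} {b} {c} a<p t+s<p ab bc with ab | bc
  ... | exact e | exact e' = exact (+-reassoc a t e e')
  ... | exact e | wrap e' = wrap (+-reassoc a t e e')
  ... | wrap e | exact e' = wrap (+-reassoc a t e (trans (xy∙z≈xz∙y b p s) (cong (_+ p) e')))
  ... | wrap e | wrap e' = ⊥-elim (<⇒≱ (+-mono-< a<p t+s<p) (begin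
      p + p         ≤⟨ m≤n+m (p + p) c ⟩
      c + (p + p)   ≡⟨ +-assoc c p p ⟨
      c + p + p     ≡⟨ +-reassoc a t e (trans (xy∙z≈xz∙y b p s) (cong (_+ p) e')) ⟨
      a + (t + s)   ∎))
    where open ≤-Reasoning

  offset : Fin p → Fin p → Fin p
  offset j v = fromℕ< (proj₁ (proj₂ (addMod-exists (toℕ<n j) (toℕ<n v))))

  offset-addMod : ∀ j v → AddMod p (toℕ j) (toℕ (offset j v)) (toℕ v)
  offset-addMod j v with t , t<p , j+t≡v ← addMod-exists (toℕ<n j) (toℕ<n v) rewrite toℕ-fromℕ< t<p = j+t≡v

  toℕ-offset : ∀ {j v t} → t < p → AddMod p (toℕ j) t (toℕ v) → toℕ (offset j v) ≡ t
  toℕ-offset {j} {v} t<p j+t≡v = addMod-functional (toℕ<n (offset j v)) t<p (offset-addMod j v) j+t≡v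

  offset-injective : ∀ j → Injective _≡_ _≡_ (offset j)
  offset-injective j {v} {v'} e = toℕ-injective (addMod-injective (toℕ<n v) (toℕ<n v') (offset-addMod j v)
    (subst (λ t → AddMod p (toℕ j) (toℕ t) (toℕ v')) (sym e) (offset-addMod j v')))

initialSegment : ∀ {n} → ℕ → Subset n
initialSegment k w = does (toℕ w <? k)

∣initialSegment∣ : ∀ {n} k → k ≤ n → ∣ initialSegment {n} k ∣ ≡ k
∣initialSegment∣ {zero} zero _ = refl
∣initialSegment∣ {suc n} zero _ = ∣initialSegment∣ {n} zero z≤n
∣initialSegment∣ {suc n} (suc k) (s≤s k≤n) = cong suc (∣initialSegment∣ k k≤n)

-- The cyclic interval {j, j + 1, …, j + k − 1} of ℤ/p.
interval : ∀ {p} → ℕ → Fin p → Subset p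
interval k j = initialSegment k ∘ offset j

∣interval∣ : ∀ {p k} j → k ≤ p → ∣ interval {p} k j ∣ ≡ k
∣interval∣ {p} {k} j k≤p = trans (∣∣-reindex (initialSegment k) (offset-injective j)) (∣initialSegment∣ k k≤p)

interval-∋ : ∀ {p k} (j v : Fin p) → toℕ (offset j v) < k → interval k j v ≡ true
interval-∋ {k = k} j v = dec-true (toℕ (offset j v) <? k)

interval-∌ : ∀ {p k} (j v : Fin p) → k ≤ toℕ (offset j v) → interval k j v ≡ false
interval-∌ {k = k} j v k≤ = dec-false (toℕ (offset j v) <? k) (≤⇒≯ k≤)

offset-self : ∀ {p} (j : Fin p) → toℕ (offset j j) ≡ 0
offset-self j = toℕ-offset (≤-<-trans z≤n (toℕ<n j)) (exact (+-identityʳ (toℕ j)))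

offset-≢0 : ∀ {p} {u u' : Fin p} → u ≢ u' → toℕ (offset u u') ≢ 0
offset-≢0 {p} {u} {u'} u≢u' δ≡0 = u≢u' (toℕ-injective (addMod-injective (toℕ<n u) (toℕ<n u')
  (exact (+-identityʳ (toℕ u))) (subst (λ t → AddMod p (toℕ u) t (toℕ u')) δ≡0 (offset-addMod u u'))))

-- If u' lies fewer than k steps after u, the interval ending at u misses u', since 2k ≤ p.
intervals-separate : ∀ {p k} → 0 < k → k + k ≤ p → ∀ {u u' : Fin p} → u ≢ u' →
  ∃[ j ] interval k j u ≡ true × interval k j u' ≡ false
intervals-separate {p} {suc k'} _ 2k≤p {u} {u'} u≢u' with toℕ (offset u u') <? suc k'
... | no δ≮k = u , interval-∋ u u (subst (_< suc k') (sym (offset-self u)) (s≤s z≤n)) , interval-∌ u u' (≮⇒≥ δ≮k)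
... | yes δ<k = j , interval-∋ j u (subst (_< suc k') (sym j→u) ≤-refl) , interval-∌ j u' (subst (suc k' ≤_) (sym j→u') far)
  where
  δ = toℕ (offset u u')
  k'<p : k' < p
  k'<p = ≤-trans (s≤s (m≤n+m k' k')) (≤-trans (+-monoʳ-≤ (suc k') (n≤1+n k')) 2k≤p)
  start = addMod-exists k'<p (toℕ<n u)
  j : Fin p
  j = fromℕ< (proj₁ (proj₂ start))
  j+k'≡u : AddMod p (toℕ j) k' (toℕ u)
  j+k'≡u rewrite toℕ-fromℕ< (proj₁ (proj₂ start)) = addMod-comm (proj₂ (proj₂ start))
  j→u : toℕ (offset j u) ≡ k'
  j→u = toℕ-offset k'<p j+k'≡u
  k'+δ<p : k' + δ < p
  k'+δ<p = ≤-trans (s≤s (+-monoʳ-≤ k' (≤-trans (s≤s⁻¹ δ<k) (n≤1+n k')))) 2k≤p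
  j→u' : toℕ (offset j u') ≡ k' + δ
  j→u' = toℕ-offset k'+δ<p (addMod-trans (toℕ<n j) k'+δ<p j+k'≡u (offset-addMod u u'))
  far : suc k' ≤ k' + δ
  far = subst (_≤ k' + δ) (+-comm k' 1) (+-monoʳ-≤ k' (n≢0⇒n>0 (offset-≢0 u≢u')))

AllPairs-lookup : ∀ {T : Set} {R : T → T → Set} {xs} → Symmetric R → AllPairs R xs →
  ∀ {i j} → i ≢ j → R (lookup xs i) (lookup xs j)
AllPairs-lookup R-sym (_ ∷ _) {fz} {fz} i≢j = ⊥-elim (i≢j refl)
AllPairs-lookup R-sym (Rx ∷ _) {fz} {fs j} _ = All.lookup Rx (∈-lookup j)
AllPairs-lookup R-sym (Rx ∷ _) {fs i} {fz} _ = R-sym (All.lookup Rx (∈-lookup i))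
AllPairs-lookup R-sym (_ ∷ Rxs) {fs i} {fs j} i≢j = AllPairs-lookup R-sym Rxs (i≢j ∘ cong fs)

toℕ-index-++⁺ˡ : ∀ {T : Set} {Pr : T → Set} {xs ys} (a : Any Pr xs) →
  toℕ (Any.index (Any.++⁺ˡ {ys = ys} a)) ≡ toℕ (Any.index a)
toℕ-index-++⁺ˡ (here _) = refl
toℕ-index-++⁺ˡ (there a) = cong suc (toℕ-index-++⁺ˡ a)

module _ {n p : ℕ} (S : Fin p → Subset n) where

  open Permutation (setoid (Subset n)) using (_↭_)
  open Permutationₚ (setoid (Subset n)) using (partition-↭; AllPairs-resp-↭; xs↭ys⇒|xs|≡|ys|)

  Chosen : Subset n → Set
  Chosen A = ∃[ j ] A ≗ S j

  chosen? : ∀ A → Dec (Chosen A)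
  chosen? A = any? (λ j → all? (λ i → A i ≟ᵇ S j i))

  chosenFirst : List (Subset n) → List (Subset n)
  chosenFirst L = filter chosen? L ++ filter (∁? chosen?) L

  ↭-chosenFirst : ∀ L → L ↭ chosenFirst L
  ↭-chosenFirst L = subst (λ (ys , zs) → L ↭ ys ++ zs) (partition-defn chosen? L) (partition-↭ chosen? L)

  -- Two chosen members equal to the same S j would be comparable.
  length-chosen≤p : ∀ {L} → AllPairs Incomparable L → length (filter chosen? L) ≤ p
  length-chosen≤p {L} L-ac = injective⇒≤ {f = proj₁ ∘ which} which-injective
    where
    which : ∀ i → Chosen (lookup (filter chosen? L) i)
    which i = All.lookup (All.all-filter chosen? L) (∈-lookup i)
    which-injective : ∀ {i i'} → proj₁ (which i) ≡ proj₁ (which i') → i ≡ i'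
    which-injective {i} {i'} e with i ≟ i'
    ... | yes i≡i' = i≡i'
    ... | no i≢i' = ⊥-elim (≗-¬incomparable (proj₂ (which i)) (subst (λ j → _ ≗ S j) (sym e) (proj₂ (which i')))
                                            (AllPairs-lookup incomparable-sym (AllPairs.filter⁺ chosen? L-ac) i≢i'))

  chosen-index : ∀ L j → Any (_≗ S j) L → ∃[ i ] toℕ i < length (filter chosen? L) × lookup (chosenFirst L) i ≗ S j
  chosen-index L j S∈L with Any.filter⁺ chosen? S∈L
  ... | inj₂ ¬chosen = ⊥-elim (¬chosen (j , Any.lookup-result S∈L))
  ... | inj₁ S∈chosen = Any.index (Any.++⁺ˡ S∈chosen) , index< , Any.lookup-index (Any.++⁺ˡ S∈chosen)
    where
    index< : toℕ (Any.index (Any.++⁺ˡ S∈chosen)) < length (filter chosen? L)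
    index< = subst (_< length (filter chosen? L)) (sym (toℕ-index-++⁺ˡ S∈chosen)) (toℕ<n (Any.index S∈chosen))

  extendToAntichain : ∀ {q} (L : List (Subset n)) → AllPairs Incomparable L → (∀ j → Any (_≗ S j) L) →
    p ≤ q → q ≤ length L → ∃[ G ] Antichain {q} G × (∀ j → ∃[ i ] G i ≗ S j)
  extendToAntichain {q} L L-ac S⊆L p≤q q≤|L| = G , G-ac , S⊆G
    where
    q≤|L'| : q ≤ length (chosenFirst L)
    q≤|L'| = subst (q ≤_) (xs↭ys⇒|xs|≡|ys| (↭-chosenFirst L)) q≤|L|
    G : Fin q → Subset n
    G i = lookup (chosenFirst L) (inject≤ i q≤|L'|)
    G-ac : Antichain G
    G-ac i≢i' = AllPairs-lookup incomparable-sym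
      (AllPairs-resp-↭ incomparable-sym (resp₂ Incomparable) (↭-chosenFirst L) L-ac) (i≢i' ∘ inject≤-injective _ _ _ _)
    S⊆G : ∀ j → ∃[ i ] G i ≗ S j
    S⊆G j with k , k< , L'k≗Sj ← chosen-index L j (S⊆L j)
      = fromℕ< k<q , subst (λ k → lookup (chosenFirst L) k ≗ S j) (sym G≡) L'k≗Sj
      where
      k<q : toℕ k < q
      k<q = <-≤-trans k< (≤-trans (length-chosen≤p L-ac) p≤q)
      G≡ : inject≤ (fromℕ< k<q) q≤|L'| ≡ k
      G≡ = toℕ-injective (trans (toℕ-inject≤ _ q≤|L'|) (toℕ-fromℕ< k<q))

SeparatesPoints : ∀ {q p} → (Fin q → Subset p) → Set
SeparatesPoints {q} {p} G = ∀ {u u' : Fin p} → u ≢ u' → ∃[ i ] G i u ≡ true × G i u' ≡ false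

separatingAntichain : ∀ {p q k} → 0 < k → k + k ≤ p → p ≤ q → q ≤ p C k →
  ∃[ G ] Antichain {q} {p} G × SeparatesPoints G
separatingAntichain {p} {q} {k} 0<k 2k≤p p≤q q≤pCk =
  separating (extendToAntichain (interval k) (kSubsets p k) (kSubsets-antichain p k) intervals∈ p≤q q≤|kSubsets|)
  where
  intervals∈ : ∀ j → Any (_≗ interval k j) (kSubsets p k)
  intervals∈ j = kSubsets-complete p k _ (∣interval∣ j (≤-trans (m≤m+n k k) 2k≤p))
  q≤|kSubsets| : q ≤ length (kSubsets p k)
  q≤|kSubsets| = subst (q ≤_) (sym (length-kSubsets p k)) q≤pCk
  separating : (∃[ G ] Antichain G × ∀ j → ∃[ i ] G i ≗ interval k j) → ∃[ G ] Antichain G × SeparatesPoints G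
  separating (G , G-ac , intervals⊆G) = G , G-ac , separates
    where
    separates : SeparatesPoints G
    separates u≢u' with j , u∈ , u'∉ ← intervals-separate 0<k 2k≤p u≢u' with i , Gi≗ ← intervals⊆G j
      = i , trans (Gi≗ _) u∈ , trans (Gi≗ _) u'∉

-- Orientations in which every ordered pair is joined by a path of length at most 2

module _ {V : Set} {G : Graph V} (D : Orientation G) where

  data Reach≤2 (a : V) : V → Set where
    stay : Reach≤2 a a
    arc  : ∀ {b} → Arc D a b → Reach≤2 a b
    via  : ∀ {b} m → Arc D a m → Arc D m b → Reach≤2 a b

  walk⇒Reach≤2 : ∀ {a b k} → Walk D a b k → k ≤ 2 → Reach≤2 a b
  walk⇒Reach≤2 here _ = stay
  walk⇒Reach≤2 (step a→b here) _ = arc a→b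
  walk⇒Reach≤2 (step a→m (step m→b here)) _ = via _ a→m m→b
  walk⇒Reach≤2 (step _ (step _ (step _ _))) (s≤s (s≤s ()))

  Reach≤2⇒walk : ∀ {a b} → Reach≤2 a b → ∃[ k ] Walk D a b k
  Reach≤2⇒walk stay = 0 , here
  Reach≤2⇒walk (arc a→b) = 1 , step a→b here
  Reach≤2⇒walk (via _ a→m m→b) = 2 , step a→m (step m→b here)

  arc? : Decidable (Adj G) → Decidable (Arc D)
  arc? adj? a b with adj? a b
  ... | no ¬adj = no (¬adj ∘ arc-adj D)
  ... | yes adj with one-dir D adj
  ...   | inj₁ a→b = yes a→b
  ...   | inj₂ b→a = no (λ a→b → antisym D a→b b→a)

  walk₀ : ∀ {a b} → Walk D a b 0 → a ≡ b
  walk₀ here = refl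

  walk₁ : ∀ {a b} → Walk D a b 1 → Arc D a b
  walk₁ (step a→b here) = a→b

  walk-length≥2 : ∀ {a b k} → a ≢ b → ¬ Adj G a b → Walk D a b k → 2 ≤ k
  walk-length≥2 a≢b _ here = ⊥-elim (a≢b refl)
  walk-length≥2 _ ¬adj (step a→b here) = ⊥-elim (¬adj (arc-adj D a→b))
  walk-length≥2 _ _ (step _ (step _ _)) = s≤s (s≤s z≤n)

  module _ (_≟ᵥ_ : DecidableEquality V) (adj? : Decidable (Adj G)) where

    Reach≤2⇒Dist : ∀ {a b} → Reach≤2 a b → ∃[ k ] Dist D a b k × k ≤ 2
    Reach≤2⇒Dist {a} {b} reach with a ≟ᵥ b | arc? adj? a b | reach
    ... | yes refl | _ | _ = 0 , (here , λ _ ()) , z≤n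
    ... | no a≢b | yes a→b | _ = 1 , (step a→b here , λ { zero _ w → a≢b (walk₀ w) ; (suc _) (s≤s ()) }) , s≤s z≤n
    ... | no a≢b | no _ | stay = ⊥-elim (a≢b refl)
    ... | no _ | no ¬a→b | arc a→b = ⊥-elim (¬a→b a→b)
    ... | no a≢b | no ¬a→b | via _ a→m m→b = 2 , (step a→m (step m→b here) , shorter) , ≤-refl
      where
      shorter : ∀ j → j < 2 → ¬ Walk D a b j
      shorter zero _ w = a≢b (walk₀ w)
      shorter (suc zero) _ w = ¬a→b (walk₁ w)
      shorter (suc (suc _)) (s≤s (s≤s ()))

    diameter-two : ∀ {a b} → a ≢ b → ¬ Adj G a b → (∀ x y → Reach≤2 x y) → Diameter D 2
    diameter-two {a} {b} a≢b ¬adj reach = (λ x y → Reach≤2⇒Dist (reach x y)) , a , b , dist-ab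
      where
      dist-ab : Dist D a b 2
      dist-ab with k , dist@(walk , _) , k≤2 ← Reach≤2⇒Dist (reach a b)
        = subst (Dist D a b) (≤-antisym k≤2 (walk-length≥2 a≢b ¬adj walk)) dist

  diameter≥2 : ∀ {a b e} → a ≢ b → ¬ Adj G a b → Diameter D e → 2 ≤ e
  diameter≥2 {a} {b} a≢b ¬adj (eccentricity , _) with k , (walk , _) , k≤e ← eccentricity a b
    = ≤-trans (walk-length≥2 a≢b ¬adj walk) k≤e

  diameter-two⇒Reach≤2 : Diameter D 2 → ∀ a b → Reach≤2 a b
  diameter-two⇒Reach≤2 (eccentricity , _) a b with k , (walk , _) , k≤2 ← eccentricity a b = walk⇒Reach≤2 walk k≤2

orientationNumber-two⇔ : ∀ {V} {G : Graph V} → DecidableEquality V → Decidable (Adj G) →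
  ∀ {a b} → a ≢ b → ¬ Adj G a b → OrientationNumber G 2 ⇔ (∃[ D ] ∀ x y → Reach≤2 {G = G} D x y)
orientationNumber-two⇔ _≟ᵥ_ adj? a≢b ¬adj = mk⇔
  (λ ((D , _ , diameter) , _) → D , diameter-two⇒Reach≤2 D diameter)
  (λ (D , reach) → (D , (λ x y → Reach≤2⇒walk D (reach x y)) , diameter-two D _≟ᵥ_ adj? a≢b ¬adj reach)
                 , (λ D' _ e → diameter≥2 D' a≢b ¬adj))

reverse : ∀ {V} {G : Graph V} → Orientation G → Orientation G
reverse {G = G} D = record
  { Arc = λ a b → Arc D b a
  ; arc-adj = λ b→a → Graph.sym G (arc-adj D b→a)
  ; one-dir = λ adj → swap (one-dir D adj)
  ; antisym = λ b→a a→b → antisym D b→a a→b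
  }

reverse-Reach≤2 : ∀ {V} {G : Graph V} {D : Orientation G} {a b} → Reach≤2 D a b → Reach≤2 (reverse D) b a
reverse-Reach≤2 stay = stay
reverse-Reach≤2 (arc a→b) = arc a→b
reverse-Reach≤2 (via m a→m m→b) = via m m→b a→m

pattern X i = inj₁ i
pattern x₁ = inj₁ fz
pattern x₂ = inj₁ (fs fz)
pattern P u = inj₂ (inj₁ u)
pattern Q w = inj₂ (inj₂ w)

_≟ᵛ_ : ∀ {a b c} → DecidableEquality (KVert a b c)
_≟ᵛ_ = ≡-dec _≟_ (≡-dec _≟_ _≟_)

kAdj? : ∀ {a b c} → Decidable (KAdj {a} {b} {c})
kAdj? u v = ¬? (part u ≟ part v)

K3-orientationNumber-two⇔ : ∀ {p q} → OrientationNumber (K3 2 p q) 2 ⇔ (∃[ D ] ∀ a b → Reach≤2 D a b)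
K3-orientationNumber-two⇔ = orientationNumber-two⇔ _≟ᵛ_ kAdj? {x₁} {x₂} (λ ()) (λ adj → adj refl)

-- Necessity: an antichain from a diameter-2 orientation

module Necessity {p q : ℕ} (D : Orientation (K3 2 p q)) (reach : ∀ a b → Reach≤2 D a b) where

  infix 4 _⟶_
  _⟶_ : KVert 2 p q → KVert 2 p q → Set
  _⟶_ = Arc D

  no-arc-in-part : ∀ {a b} → part a ≡ part b → ¬ a ⟶ b
  no-arc-in-part same a→b = arc-adj D a→b same

  _⟶?_ : Decidable _⟶_
  _⟶?_ = arc? D kAdj?

  detour : ∀ {a b} → a ≢ b → ¬ a ⟶ b → ∃[ m ] a ⟶ m × m ⟶ b
  detour {a} {b} a≢b ¬a→b with reach a b
  ... | stay = ⊥-elim (a≢b refl)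
  ... | arc a→b = ⊥-elim (¬a→b a→b)
  ... | via m a→m m→b = m , a→m , m→b

  P⇝Q-via-X : ∀ {u w} → Q w ⟶ P u → ∃[ i ] P u ⟶ X i × X i ⟶ Q w
  P⇝Q-via-X w→u with detour (λ ()) (antisym D w→u)
  ... | X i , u→i , i→w = i , u→i , i→w
  ... | P _ , u→u' , _ = ⊥-elim (no-arc-in-part refl u→u')
  ... | Q _ , _ , w'→w = ⊥-elim (no-arc-in-part refl w'→w)

  Q⇝P-via-X : ∀ {u w} → P u ⟶ Q w → ∃[ i ] Q w ⟶ X i × X i ⟶ P u
  Q⇝P-via-X u→w with detour (λ ()) (antisym D u→w)
  ... | X i , w→i , i→u = i , w→i , i→u
  ... | P _ , _ , u'→u = ⊥-elim (no-arc-in-part refl u'→u)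
  ... | Q _ , w→w' , _ = ⊥-elim (no-arc-in-part refl w→w')

  X⇝Q-via-P : ∀ {i w} → Q w ⟶ X i → ∃[ u ] X i ⟶ P u × P u ⟶ Q w
  X⇝Q-via-P w→i with detour (λ ()) (antisym D w→i)
  ... | P u , i→u , u→w = u , i→u , u→w
  ... | X _ , i→j , _ = ⊥-elim (no-arc-in-part refl i→j)
  ... | Q _ , _ , w'→w = ⊥-elim (no-arc-in-part refl w'→w)

  Q⇝X-via-P : ∀ {i w} → X i ⟶ Q w → ∃[ u ] Q w ⟶ P u × P u ⟶ X i
  Q⇝X-via-P i→w with detour (λ ()) (antisym D i→w)
  ... | P u , w→u , u→i = u , w→u , u→i
  ... | X _ , _ , j→i = ⊥-elim (no-arc-in-part refl j→i)
  ... | Q _ , w→w' , _ = ⊥-elim (no-arc-in-part refl w→w')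

  Q⇝Q : ∀ {w w'} → w ≢ w' → (∃[ u ] Q w ⟶ P u × P u ⟶ Q w') ⊎ (∃[ i ] Q w ⟶ X i × X i ⟶ Q w')
  Q⇝Q w≢w' with detour (λ { refl → w≢w' refl }) (no-arc-in-part refl)
  ... | P u , w→u , u→w' = inj₁ (u , w→u , u→w')
  ... | X i , w→i , i→w' = inj₂ (i , w→i , i→w')
  ... | Q _ , w→w'' , _ = ⊥-elim (no-arc-in-part refl w→w'')

  X⇝X : ∀ {i j} → i ≢ j → (∃[ u ] X i ⟶ P u × P u ⟶ X j) ⊎ (∃[ w ] X i ⟶ Q w × Q w ⟶ X j)
  X⇝X i≢j with detour (λ { refl → i≢j refl }) (no-arc-in-part refl)
  ... | P u , i→u , u→j = inj₁ (u , i→u , u→j)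
  ... | Q w , i→w , w→j = inj₂ (w , i→w , w→j)
  ... | X _ , i→k , _ = ⊥-elim (no-arc-in-part refl i→k)

  data Class (w : Fin q) : Set where
    through₂₁ : x₂ ⟶ Q w → Q w ⟶ x₁ → Class w
    through₁₂ : x₁ ⟶ Q w → Q w ⟶ x₂ → Class w
    sink      : x₁ ⟶ Q w → x₂ ⟶ Q w → Class w
    source    : Q w ⟶ x₁ → Q w ⟶ x₂ → Class w

  classify : ∀ w → Class w
  classify w with one-dir D {x₁} {Q w} (λ ()) | one-dir D {x₂} {Q w} (λ ())
  ... | inj₁ 1→w | inj₁ 2→w = sink 1→w 2→w
  ... | inj₁ 1→w | inj₂ w→2 = through₁₂ 1→w w→2
  ... | inj₂ w→1 | inj₁ 2→w = through₂₁ 2→w w→1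
  ... | inj₂ w→1 | inj₂ w→2 = source w→1 w→2

  through₂₁-split : ∀ {w} → x₂ ⟶ Q w → Q w ⟶ x₁ → ∀ u → (Q w ⟶ P u × P u ⟶ x₂) ⊎ (x₁ ⟶ P u × P u ⟶ Q w)
  through₂₁-split {w} 2→w w→1 u with one-dir D {P u} {Q w} (λ ())
  ... | inj₂ w→u with P⇝Q-via-X w→u
  ...   | fz , _ , 1→w = ⊥-elim (antisym D w→1 1→w)
  ...   | fs fz , u→2 , _ = inj₁ (w→u , u→2)
  through₂₁-split {w} 2→w w→1 u | inj₁ u→w with Q⇝P-via-X u→w
  ...   | fz , _ , 1→u = inj₂ (1→u , u→w)
  ...   | fs fz , w→2 , _ = ⊥-elim (antisym D 2→w w→2)

  through₁₂-split : ∀ {w} → x₁ ⟶ Q w → Q w ⟶ x₂ → ∀ u → (Q w ⟶ P u × P u ⟶ x₁) ⊎ (x₂ ⟶ P u × P u ⟶ Q w)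
  through₁₂-split {w} 1→w w→2 u with one-dir D {P u} {Q w} (λ ())
  ... | inj₂ w→u with P⇝Q-via-X w→u
  ...   | fz , u→1 , _ = inj₁ (w→u , u→1)
  ...   | fs fz , _ , 2→w = ⊥-elim (antisym D w→2 2→w)
  through₁₂-split {w} 1→w w→2 u | inj₁ u→w with Q⇝P-via-X u→w
  ...   | fz , w→1 , _ = ⊥-elim (antisym D 1→w w→1)
  ...   | fs fz , _ , 2→u = inj₂ (2→u , u→w)

  sink-split : ∀ {w} → x₁ ⟶ Q w → x₂ ⟶ Q w → ∀ u → Q w ⟶ P u × (P u ⟶ x₁ ⊎ P u ⟶ x₂)
  sink-split {w} 1→w 2→w u with one-dir D {P u} {Q w} (λ ())
  ... | inj₂ w→u with P⇝Q-via-X w→u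
  ...   | fz , u→1 , _ = w→u , inj₁ u→1
  ...   | fs fz , u→2 , _ = w→u , inj₂ u→2
  sink-split {w} 1→w 2→w u | inj₁ u→w with Q⇝P-via-X u→w
  ...   | fz , w→1 , _ = ⊥-elim (antisym D 1→w w→1)
  ...   | fs fz , w→2 , _ = ⊥-elim (antisym D 2→w w→2)

  source-split : ∀ {w} → Q w ⟶ x₁ → Q w ⟶ x₂ → ∀ u → P u ⟶ Q w × (x₁ ⟶ P u ⊎ x₂ ⟶ P u)
  source-split {w} w→1 w→2 u with one-dir D {P u} {Q w} (λ ())
  ... | inj₁ u→w with Q⇝P-via-X u→w
  ...   | fz , _ , 1→u = u→w , inj₁ 1→u
  ...   | fs fz , _ , 2→u = u→w , inj₂ 2→u
  source-split {w} w→1 w→2 u | inj₂ w→u with P⇝Q-via-X w→u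
  ...   | fz , _ , 1→w = ⊥-elim (antisym D w→1 1→w)
  ...   | fs fz , _ , 2→w = ⊥-elim (antisym D w→2 2→w)

  sink-unique : ∀ {w w'} → w ≢ w' → x₁ ⟶ Q w → x₂ ⟶ Q w → x₁ ⟶ Q w' → x₂ ⟶ Q w' → ⊥
  sink-unique w≢w' 1→w 2→w 1→w' 2→w' with Q⇝Q w≢w'
  ... | inj₁ (u , _ , u→w') = antisym D u→w' (proj₁ (sink-split 1→w' 2→w' u))
  ... | inj₂ (fz , w→1 , _) = antisym D w→1 1→w
  ... | inj₂ (fs fz , w→2 , _) = antisym D w→2 2→w

  source-unique : ∀ {w w'} → w ≢ w' → Q w ⟶ x₁ → Q w ⟶ x₂ → Q w' ⟶ x₁ → Q w' ⟶ x₂ → ⊥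
  source-unique w≢w' w→1 w→2 w'→1 w'→2 with Q⇝Q w≢w'
  ... | inj₁ (u , w→u , _) = antisym D w→u (proj₁ (source-split w→1 w→2 u))
  ... | inj₂ (fz , _ , 1→w') = antisym D w'→1 1→w'
  ... | inj₂ (fs fz , _ , 2→w') = antisym D w'→2 2→w'

  out : KVert 2 p q → Subset p
  out a u = does (a ⟶? P u)

  into : KVert 2 p q → Subset p
  into a u = does (P u ⟶? a)

  ∈out : ∀ {a u} → a ⟶ P u → out a u ≡ true
  ∈out {a} {u} = dec-true (a ⟶? P u)

  ∉out : ∀ {a u} → P u ⟶ a → out a u ≡ false
  ∉out {a} {u} u→a = dec-false (a ⟶? P u) (λ a→u → antisym D a→u u→a)

  ∈into : ∀ {a u} → P u ⟶ a → into a u ≡ true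
  ∈into {a} {u} = dec-true (P u ⟶? a)

  ∉into : ∀ {a u} → a ⟶ P u → into a u ≡ false
  ∉into {a} {u} a→u = dec-false (P u ⟶? a) (λ u→a → antisym D a→u u→a)

  module WithThrough₂₁ {w₁ : Fin q} (2→w₁ : x₂ ⟶ Q w₁) (w₁→1 : Q w₁ ⟶ x₁) where

    out₂⊆out₁ : ∀ {u} → x₂ ⟶ P u → x₁ ⟶ P u
    out₂⊆out₁ {u} 2→u with through₂₁-split 2→w₁ w₁→1 u
    ... | inj₁ (_ , u→2) = ⊥-elim (antisym D 2→u u→2)
    ... | inj₂ (1→u , _) = 1→u

    no-sink-and-through₁₂ : ∀ {w w'} → x₁ ⟶ Q w → x₂ ⟶ Q w → x₁ ⟶ Q w' → Q w' ⟶ x₂ → ⊥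
    no-sink-and-through₁₂ 1→w 2→w 1→w' w'→2 with u , 1→u , _ ← X⇝Q-via-P w₁→1 with through₁₂-split 1→w' w'→2 u
    ... | inj₁ (_ , u→1) = antisym D 1→u u→1
    ... | inj₂ (2→u , _) with proj₂ (sink-split 1→w 2→w u)
    ...   | inj₁ u→1 = antisym D 1→u u→1
    ...   | inj₂ u→2 = antisym D 2→u u→2

    no-sink-and-source : ∀ {w w'} → x₁ ⟶ Q w → x₂ ⟶ Q w → Q w' ⟶ x₁ → Q w' ⟶ x₂ → ⊥
    no-sink-and-source 1→w 2→w w'→1 w'→2 with u , _ , u→1 ← Q⇝X-via-P 1→w with one-dir D {x₂} {P u} (λ ())
    ... | inj₁ 2→u = antisym D (out₂⊆out₁ 2→u) u→1
    ... | inj₂ u→2 with proj₂ (source-split w'→1 w'→2 u)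
    ...   | inj₁ 1→u = antisym D 1→u u→1
    ...   | inj₂ 2→u = antisym D 2→u u→2

    no-source-and-through₁₂ : ∀ {w w'} → Q w ⟶ x₁ → Q w ⟶ x₂ → x₁ ⟶ Q w' → Q w' ⟶ x₂ → ⊥
    no-source-and-through₁₂ w→1 w→2 1→w' w'→2 with u , _ , u→1 ← Q⇝X-via-P 1→w' with proj₂ (source-split w→1 w→2 u)
    ... | inj₁ 1→u = antisym D 1→u u→1
    ... | inj₂ 2→u = antisym D (out₂⊆out₁ 2→u) u→1

    family-of : ∀ {w} → Class w → Subset p
    family-of {w} (through₂₁ _ _) = out (Q w)
    family-of {w} (through₁₂ _ _) = into (Q w)
    family-of (sink _ _) = out x₁
    family-of (source _ _) = out x₂

    family-⊈ : ∀ {w w'} → w ≢ w' → (c : Class w) (c' : Class w') → family-of c ⊈ family-of c'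
    family-⊈ w≢w' (through₂₁ 2→w w→1) (through₂₁ 2→w' w'→1) with Q⇝Q w≢w'
    ... | inj₁ (u , w→u , u→w') = u , ∈out w→u , ∉out u→w'
    ... | inj₂ (fz , _ , 1→w') = ⊥-elim (antisym D w'→1 1→w')
    ... | inj₂ (fs fz , w→2 , _) = ⊥-elim (antisym D 2→w w→2)
    family-⊈ w≢w' (through₁₂ 1→w w→2) (through₁₂ 1→w' w'→2) with Q⇝Q (w≢w' ∘ sym)
    ... | inj₁ (u , w'→u , u→w) = u , ∈into u→w , ∉into w'→u
    ... | inj₂ (fz , w'→1 , _) = ⊥-elim (antisym D 1→w' w'→1)
    ... | inj₂ (fs fz , _ , 2→w) = ⊥-elim (antisym D w→2 2→w)
    family-⊈ _ (through₂₁ 2→w _) (through₁₂ 1→w' w'→2) with u , w→u , u→2 ← Q⇝X-via-P 2→w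
      with through₁₂-split 1→w' w'→2 u
    ... | inj₁ (w'→u , _) = u , ∈out w→u , ∉into w'→u
    ... | inj₂ (2→u , _) = ⊥-elim (antisym D 2→u u→2)
    family-⊈ _ (through₁₂ _ w→2) (through₂₁ 2→w' w'→1) with u , 2→u , u→w ← X⇝Q-via-P w→2
      with through₂₁-split 2→w' w'→1 u
    ... | inj₁ (_ , u→2) = ⊥-elim (antisym D 2→u u→2)
    ... | inj₂ (_ , u→w') = u , ∈into u→w , ∉out u→w'
    family-⊈ _ (through₂₁ 2→w w→1) (sink 1→w' _) with u , w'→u , u→1 ← Q⇝X-via-P 1→w'
      with through₂₁-split 2→w w→1 u
    ... | inj₁ (w→u , _) = u , ∈out w→u , ∉out u→1
    ... | inj₂ (1→u , _) = ⊥-elim (antisym D 1→u u→1)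
    family-⊈ _ (sink _ _) (through₂₁ _ w'→1) with u , 1→u , u→w' ← X⇝Q-via-P w'→1 = u , ∈out 1→u , ∉out u→w'
    family-⊈ _ (through₂₁ 2→w _) (source _ _) with u , w→u , u→2 ← Q⇝X-via-P 2→w = u , ∈out w→u , ∉out u→2
    family-⊈ _ (source _ w→2) (through₂₁ 2→w' w'→1) with u , 2→u , u→w ← X⇝Q-via-P w→2
      with through₂₁-split 2→w' w'→1 u
    ... | inj₁ (_ , u→2) = ⊥-elim (antisym D 2→u u→2)
    ... | inj₂ (_ , u→w') = u , ∈out 2→u , ∉out u→w'
    family-⊈ w≢w' (sink 1→w 2→w) (sink 1→w' 2→w') = ⊥-elim (sink-unique w≢w' 1→w 2→w 1→w' 2→w')
    family-⊈ w≢w' (source w→1 w→2) (source w'→1 w'→2) = ⊥-elim (source-unique w≢w' w→1 w→2 w'→1 w'→2)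
    family-⊈ _ (sink 1→w 2→w) (through₁₂ 1→w' w'→2) = ⊥-elim (no-sink-and-through₁₂ 1→w 2→w 1→w' w'→2)
    family-⊈ _ (through₁₂ 1→w w→2) (sink 1→w' 2→w') = ⊥-elim (no-sink-and-through₁₂ 1→w' 2→w' 1→w w→2)
    family-⊈ _ (sink 1→w 2→w) (source w'→1 w'→2) = ⊥-elim (no-sink-and-source 1→w 2→w w'→1 w'→2)
    family-⊈ _ (source w→1 w→2) (sink 1→w' 2→w') = ⊥-elim (no-sink-and-source 1→w' 2→w' w→1 w→2)
    family-⊈ _ (source w→1 w→2) (through₁₂ 1→w' w'→2) = ⊥-elim (no-source-and-through₁₂ w→1 w→2 1→w' w'→2)
    family-⊈ _ (through₁₂ 1→w w→2) (source w'→1 w'→2) = ⊥-elim (no-source-and-through₁₂ w'→1 w'→2 1→w w→2)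

    family : Fin q → Subset p
    family w = family-of (classify w)

    family-antichain : Antichain family
    family-antichain {w} {w'} w≢w' =
      family-⊈ w≢w' (classify w) (classify w') , family-⊈ (w≢w' ∘ sym) (classify w') (classify w)

  module WithoutThrough (no₂₁ : ∀ {w} → x₂ ⟶ Q w → ¬ Q w ⟶ x₁) (no₁₂ : ∀ {w} → x₁ ⟶ Q w → ¬ Q w ⟶ x₂) where

    family-of : ∀ {w} → Class w → Subset p
    family-of (through₂₁ 2→w w→1) = ⊥-elim (no₂₁ 2→w w→1)
    family-of (through₁₂ 1→w w→2) = ⊥-elim (no₁₂ 1→w w→2)
    family-of (sink _ _) = out x₂
    family-of (source _ _) = out x₁

    family-⊈ : ∀ {w w'} → w ≢ w' → (c : Class w) (c' : Class w') → family-of c ⊈ family-of c'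
    family-⊈ _ (through₂₁ 2→w w→1) _ = ⊥-elim (no₂₁ 2→w w→1)
    family-⊈ _ (through₁₂ 1→w w→2) _ = ⊥-elim (no₁₂ 1→w w→2)
    family-⊈ _ (sink _ _) (through₂₁ 2→w' w'→1) = ⊥-elim (no₂₁ 2→w' w'→1)
    family-⊈ _ (sink _ _) (through₁₂ 1→w' w'→2) = ⊥-elim (no₁₂ 1→w' w'→2)
    family-⊈ _ (source _ _) (through₂₁ 2→w' w'→1) = ⊥-elim (no₂₁ 2→w' w'→1)
    family-⊈ _ (source _ _) (through₁₂ 1→w' w'→2) = ⊥-elim (no₁₂ 1→w' w'→2)
    family-⊈ w≢w' (sink 1→w 2→w) (sink 1→w' 2→w') = ⊥-elim (sink-unique w≢w' 1→w 2→w 1→w' 2→w')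
    family-⊈ w≢w' (source w→1 w→2) (source w'→1 w'→2) = ⊥-elim (source-unique w≢w' w→1 w→2 w'→1 w'→2)
    family-⊈ _ (sink _ _) (source _ _) with X⇝X {fs fz} {fz} (λ ())
    ... | inj₁ (u , 2→u , u→1) = u , ∈out 2→u , ∉out u→1
    ... | inj₂ (w'' , 2→w'' , w''→1) = ⊥-elim (no₂₁ 2→w'' w''→1)
    family-⊈ _ (source _ _) (sink _ _) with X⇝X {fz} {fs fz} (λ ())
    ... | inj₁ (u , 1→u , u→2) = u , ∈out 1→u , ∉out u→2
    ... | inj₂ (w'' , 1→w'' , w''→2) = ⊥-elim (no₁₂ 1→w'' w''→2)

    family : Fin q → Subset p
    family w = family-of (classify w)

    family-antichain : Antichain family
    family-antichain {w} {w'} w≢w' =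
      family-⊈ w≢w' (classify w) (classify w') , family-⊈ (w≢w' ∘ sym) (classify w') (classify w)

-- Reversing every arc turns a vertex on a path x₁ → Q w → x₂ into one on a path x₂ → Q w → x₁.
Reach≤2⇒antichain : ∀ {p q} (D : Orientation (K3 2 p q)) → (∀ a b → Reach≤2 D a b) → ∃[ F ] Antichain {q} {p} F
Reach≤2⇒antichain {p} {q} D reach with any? (λ w → (x₂ ⟶? Q w) ×-dec (Q w ⟶? x₁))
  where open Necessity D reach
... | yes (_ , 2→w₁ , w₁→1) = family , family-antichain
  where open Necessity.WithThrough₂₁ D reach 2→w₁ w₁→1
... | no no₂₁ with any? (λ w → (x₁ ⟶? Q w) ×-dec (Q w ⟶? x₂))
  where open Necessity D reach
...   | yes (_ , 1→w₁ , w₁→2) = family , family-antichain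
  where open Necessity.WithThrough₂₁ (reverse D) (λ a b → reverse-Reach≤2 (reach b a)) w₁→2 1→w₁
...   | no no₁₂ = family , family-antichain
  where open Necessity.WithoutThrough D reach (λ 2→w w→1 → no₂₁ (_ , 2→w , w→1)) (λ 1→w w→2 → no₁₂ (_ , 1→w , w→2))

-- Sufficiency: a diameter-2 orientation from an antichain that separates points

other : ∀ {n} → 2 ≤ n → (i : Fin n) → ∃[ j ] i ≢ j
other (s≤s (s≤s _)) fz = fs fz , λ ()
other (s≤s (s≤s _)) (fs _) = fz , λ ()

module Construction {p q : ℕ} (F : Fin q → Subset p) where

  infix 4 _⟶_
  data _⟶_ : KVert 2 p q → KVert 2 p q → Set where
    x₁⟶P : ∀ {u} → x₁ ⟶ P u
    P⟶x₂ : ∀ {u} → P u ⟶ x₂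
    x₂⟶Q : ∀ {w} → x₂ ⟶ Q w
    Q⟶x₁ : ∀ {w} → Q w ⟶ x₁
    P⟶Q  : ∀ {u w} → F w u ≡ true → P u ⟶ Q w
    Q⟶P  : ∀ {u w} → F w u ≡ false → Q w ⟶ P u

  ⟶-adj : ∀ {a b} → a ⟶ b → KAdj a b
  ⟶-adj x₁⟶P ()
  ⟶-adj P⟶x₂ ()
  ⟶-adj x₂⟶Q ()
  ⟶-adj Q⟶x₁ ()
  ⟶-adj (P⟶Q _) ()
  ⟶-adj (Q⟶P _) ()

  P⟶Q⊎Q⟶P : ∀ u w → P u ⟶ Q w ⊎ Q w ⟶ P u
  P⟶Q⊎Q⟶P u w with F w u in Fwu
  ... | true = inj₁ (P⟶Q Fwu)
  ... | false = inj₂ (Q⟶P Fwu)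

  ⟶-one-dir : ∀ {a b} → KAdj a b → a ⟶ b ⊎ b ⟶ a
  ⟶-one-dir {x₁} {P _} _ = inj₁ x₁⟶P
  ⟶-one-dir {x₂} {P _} _ = inj₂ P⟶x₂
  ⟶-one-dir {x₁} {Q _} _ = inj₂ Q⟶x₁
  ⟶-one-dir {x₂} {Q _} _ = inj₁ x₂⟶Q
  ⟶-one-dir {P _} {x₁} _ = inj₂ x₁⟶P
  ⟶-one-dir {P _} {x₂} _ = inj₁ P⟶x₂
  ⟶-one-dir {Q _} {x₁} _ = inj₁ Q⟶x₁
  ⟶-one-dir {Q _} {x₂} _ = inj₂ x₂⟶Q
  ⟶-one-dir {P u} {Q w} _ = P⟶Q⊎Q⟶P u w
  ⟶-one-dir {Q w} {P u} _ = swap (P⟶Q⊎Q⟶P u w)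
  ⟶-one-dir {X _} {X _} adj = ⊥-elim (adj refl)
  ⟶-one-dir {P _} {P _} adj = ⊥-elim (adj refl)
  ⟶-one-dir {Q _} {Q _} adj = ⊥-elim (adj refl)

  ⟶-antisym : ∀ {a b} → a ⟶ b → ¬ b ⟶ a
  ⟶-antisym x₁⟶P ()
  ⟶-antisym P⟶x₂ ()
  ⟶-antisym x₂⟶Q ()
  ⟶-antisym Q⟶x₁ ()
  ⟶-antisym (P⟶Q Fwu) (Q⟶P Fwu') with () ← trans (sym Fwu) Fwu'
  ⟶-antisym (Q⟶P Fwu') (P⟶Q Fwu) with () ← trans (sym Fwu) Fwu'

  orientation : Orientation (K3 2 p q)
  orientation = record { Arc = _⟶_ ; arc-adj = ⟶-adj ; one-dir = ⟶-one-dir ; antisym = ⟶-antisym }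

  module _ (2≤p : 2 ≤ p) (2≤q : 2 ≤ q) (F-ac : Antichain F) (F-sep : SeparatesPoints F) where

    member : ∀ w → ∃[ u ] F w u ≡ true
    member w with w' , w≢w' ← other 2≤q w with u , Fwu , _ ← proj₁ (F-ac w≢w') = u , Fwu

    non-member : ∀ w → ∃[ u ] F w u ≡ false
    non-member w with w' , w≢w' ← other 2≤q w with u , _ , Fwu ← proj₂ (F-ac w≢w') = u , Fwu

    containing : ∀ u → ∃[ w ] F w u ≡ true
    containing u with u' , u≢u' ← other 2≤p u with w , Fwu , _ ← F-sep u≢u' = w , Fwu

    avoiding : ∀ u → ∃[ w ] F w u ≡ false
    avoiding u with u' , u≢u' ← other 2≤p u with w , _ , Fwu ← F-sep (u≢u' ∘ sym) = w , Fwu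

    reach : ∀ a b → Reach≤2 orientation a b
    reach x₁ x₁ = stay
    reach x₂ x₂ = stay
    reach x₁ x₂ = via (P (fromℕ< 2≤p)) x₁⟶P P⟶x₂
    reach x₂ x₁ = via (Q (fromℕ< 2≤q)) x₂⟶Q Q⟶x₁
    reach x₁ (P u) = arc x₁⟶P
    reach x₂ (Q w) = arc x₂⟶Q
    reach (P u) x₂ = arc P⟶x₂
    reach (Q w) x₁ = arc Q⟶x₁
    reach x₁ (Q w) with u , Fwu ← member w = via (P u) x₁⟶P (P⟶Q Fwu)
    reach (Q w) x₂ with u , Fwu ← non-member w = via (P u) (Q⟶P Fwu) P⟶x₂
    reach x₂ (P u) with w , Fwu ← avoiding u = via (Q w) x₂⟶Q (Q⟶P Fwu)
    reach (P u) x₁ with w , Fwu ← containing u = via (Q w) (P⟶Q Fwu) Q⟶x₁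
    reach (P u) (Q w) with P⟶Q⊎Q⟶P u w
    ... | inj₁ u⟶w = arc u⟶w
    ... | inj₂ _ = via x₂ P⟶x₂ x₂⟶Q
    reach (Q w) (P u) with P⟶Q⊎Q⟶P u w
    ... | inj₁ _ = via x₁ Q⟶x₁ x₁⟶P
    ... | inj₂ w⟶u = arc w⟶u
    reach (P u) (P u') with u ≟ u'
    ... | yes refl = stay
    ... | no u≢u' with w , Fwu , Fwu' ← F-sep u≢u' = via (Q w) (P⟶Q Fwu) (Q⟶P Fwu')
    reach (Q w) (Q w') with w ≟ w'
    ... | yes refl = stay
    ... | no w≢w' with u , Fw'u , Fwu ← proj₂ (F-ac w≢w') = via (P u) (Q⟶P Fwu) (P⟶Q Fw'u)

separatingAntichain⇒Reach≤2 : ∀ {p q} → 2 ≤ p → 2 ≤ q → (∃[ F ] Antichain {q} {p} F × SeparatesPoints F) →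
  ∃[ D ] ∀ a b → Reach≤2 {G = K3 2 p q} D a b
separatingAntichain⇒Reach≤2 2≤p 2≤q (F , F-ac , F-sep) = orientation , reach 2≤p 2≤q F-ac F-sep
  where open Construction F

theorem2p5 : ∀ (p q : ℕ) → 2 ≤ p → p ≤ q →
    OrientationNumber (K3 2 p q) 2 ⇔ (q ≤ p C (p / 2))
theorem2p5 p q 2≤p p≤q = mk⇔ necessity sufficiency ⇔-∘ K3-orientationNumber-two⇔
  where
  necessity : (∃[ D ] ∀ a b → Reach≤2 D a b) → q ≤ p C (p / 2)
  necessity (D , reach) = uncurry sperner-family (Reach≤2⇒antichain D reach)
  sufficiency : q ≤ p C (p / 2) → ∃[ D ] ∀ a b → Reach≤2 D a b
  sufficiency q≤C = separatingAntichain⇒Reach≤2 2≤p (≤-trans 2≤p p≤q)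
    (separatingAntichain (m≥n⇒m/n>0 2≤p) (half+half≤n p) p≤q q≤C)
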